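{- Let $L$ be an $r\times s$ partial Latin rectangle on the symbol set $[n]$. Suppose $L$ has $r'$ non-empty rows, $s'$ non-empty columns, and $n'$ symbols that occur in $L$. Let $\overline{L}$ be the $r'\times s'$ partial Latin rectangle on the symbol set $[n']$ obtained from $L$ by deleting its empty rows and empty columns and relabeling the symbols occurring in $L$ bijectively by $[n']$. Then $$|\mathrm{Atop}(L)|=(r-r')!\,(s-s')!\,(n-n')!\,|\mathrm{Atop}(\overline{L})|.$$
   Context: Let $[m]=\{1,\dots,m\}$ and $S_m$ the symmetric group on $[m]$. An $r\times s$ partial Latin rectangle (on $n$ symbols) is an $r\times s$ array whose cells contain either a symbol from $[n]$ or are empty, such that each symbol of $[n]$ occurs at most once in each row and at most once in each column. For such $L$, $L[i,j]$ denotes the symbol in cell $(i,j)$, and $\mathrm{Ent}(L)=\{(i,j,L[i,j]): \text{cell }(i,j)\text{ non-empty}\}$. A triple $\theta=(\alpha,\beta,\gamma)\in S_r\times S_s\times S_n$ acts on $L$ giving $L^\theta$ with $\mathrm{Ent}(L^\theta)=\{(\alpha(i),\beta(j),\gamma(L[i,j])):(i,j,L[i,j])\in\mathrm{Ent}(L)\}$; $\theta$ is an autotopism of $L$ if $L^\theta=L$, and $\mathrm{Atop}(L)\le S_r\times S_s\times S_n$ denotes the group of autotopisms of $L$. A row (column) is empty if all its cells are empty. -}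

module Defs where

open import Data.Nat using (ℕ; _*_; _∸_; _<_; _!)
open import Data.Fin using (Fin; toℕ)
open import Data.Maybe using (Maybe; just; nothing)
import Data.Maybe
open import Data.Vec using (Vec; lookup)
open import Data.List using (List; length)
open import Data.List.Membership.Propositional using (_∈_)
open import Data.List.Relation.Unary.Unique.Propositional using (Unique)
open import Data.Product using (Σ; ∃; _×_; _,_)
open import Function.Bundles using (_⇔_)
open import Function.Definitions using (Bijective; Injective)
open import Relation.Binary.PropositionalEquality using (_≡_)
open import Relation.Nullary using (¬_)

Array : ℕ → ℕ → ℕ → Set
Array r s n = Fin r → Fin s → Maybe (Fin n)

IsPLR : ∀ {r s n} → Array r s n → Set
IsPLR {r} {s} {n} L =
  (∀ (i : Fin r) (j j' : Fin s) (x : Fin n) → L i j ≡ just x → L i j' ≡ just x → j ≡ j')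
  × (∀ (i i' : Fin r) (j : Fin s) (x : Fin n) → L i j ≡ just x → L i' j ≡ just x → i ≡ i')

Ent : ∀ {r s n} → Array r s n → Fin r × Fin s × Fin n → Set
Ent L (i , j , x) = L i j ≡ just x

-- A permutation of [m], represented by its table (the value table of the map).
Tab : ℕ → Set
Tab m = Vec (Fin m) m

IsPerm : ∀ {m} → Tab m → Set
IsPerm v = Bijective _≡_ _≡_ (lookup v)

EntAct : ∀ {r s n} → Tab r × Tab s × Tab n → Array r s n → Fin r × Fin s × Fin n → Set
EntAct (α , β , γ) L (i' , j' , x') =
  ∃ λ i → ∃ λ j → ∃ λ x → Ent L (i , j , x)
    × lookup α i ≡ i' × lookup β j ≡ j' × lookup γ x ≡ x'

IsAutotopism : ∀ {r s n} → Array r s n → Tab r × Tab s × Tab n → Set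
IsAutotopism L θ@(α , β , γ) =
  IsPerm α × IsPerm β × IsPerm γ × (∀ t → EntAct θ L t ⇔ Ent L t)

Card : {A : Set} → (A → Set) → ℕ → Set
Card {A} P k = Σ (List A) λ xs → Unique xs × (∀ x → x ∈ xs ⇔ P x) × length xs ≡ k

EmptyRow : ∀ {r s n} → Array r s n → Fin r → Set
EmptyRow L i = ∀ j → L i j ≡ nothing

EmptyCol : ∀ {r s n} → Array r s n → Fin s → Set
EmptyCol L j = ∀ i → L i j ≡ nothing

Occurs : ∀ {r s n} → Array r s n → Fin n → Set
Occurs L x = ∃ λ i → ∃ λ j → L i j ≡ just x

StrictlyIncreasing : ∀ {a b} → (Fin a → Fin b) → Set
StrictlyIncreasing f = ∀ i j → toℕ i < toℕ j → toℕ (f i) < toℕ (f j)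

EnumeratesOnto : ∀ {a} {B : Set} → (Fin a → B) → (B → Set) → Set
EnumeratesOnto {a} {B} f P =
  Injective _≡_ _≡_ f × (∀ y → P y ⇔ (∃ λ (i : Fin a) → f i ≡ y))

IsReduction : ∀ {r s n r' s' n'} → Array r s n → Array r' s' n' → Set
IsReduction {r} {s} {n} {r'} {s'} {n'} L Lbar =
  ∃ λ (ρ : Fin r' → Fin r) → ∃ λ (σ : Fin s' → Fin s) → ∃ λ (τ : Fin n' → Fin n) →
    StrictlyIncreasing ρ × EnumeratesOnto ρ (λ i → ¬ EmptyRow L i)
    × StrictlyIncreasing σ × EnumeratesOnto σ (λ j → ¬ EmptyCol L j)
    × EnumeratesOnto τ (Occurs L)
    × (∀ i j → L (ρ i) (σ j) ≡ Data.Maybe.map τ (Lbar i j))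

-- An autotopism (α, β, γ) of L sends a row to an empty row exactly when the row
-- itself is empty (β is onto and γ one-to-one), and likewise for columns and for
-- the symbols occurring in L. Hence α, β, γ restrict to permutations of the
-- non-empty rows, non-empty columns and occurring symbols, which read through the
-- relabellings ρ, σ, τ form an autotopism of Lbar, and to arbitrary permutations
-- of the r − r' empty rows, s − s' empty columns and n − n' unused symbols.
-- Conversely any such data glue to an autotopism of L, because every cell off the
-- non-empty rows and columns is empty.

module Submission where

open import Defs
open import Data.Nat using (ℕ; zero; suc; _+_; _*_; _∸_; _!)
open import Data.Nat.Properties using (m+n∸m≡n)
open import Data.Fin using (Fin; zero; suc; punchIn; punchOut; _≟_; splitAt; join)
open import Data.Fin.Properties
  using (punchIn-injective; punchInᵢ≢i; punchIn-punchOut; suc-injective; any?;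
         cantor-schröder-bernstein; splitAt-join; join-splitAt)
open import Data.Maybe using (Maybe; just; nothing)
import Data.Maybe as Maybe
open import Data.Maybe.Properties using (map-injective; map-∘; map-cong)
open import Data.Vec using (Vec; []; _∷_; lookup; tabulate)
import Data.Vec as Vec
open import Data.Vec.Properties using (lookup∘tabulate; tabulate∘lookup; tabulate-cong; lookup-map)
import Data.Vec.Functional as Vector
open import Data.List using (List; []; _∷_; length; map; cartesianProduct; allFin)
open import Data.List.Properties using (length-map; length-++; length-tabulate)
open import Data.List.Membership.Propositional using (_∈_)
open import Data.List.Membership.Propositional.Properties
  using (∈-map⁺; ∈-map⁻; ∈-cartesianProduct⁺; ∈-cartesianProduct⁻; ∈-allFin)
open import Data.List.Relation.Unary.Unique.Propositional.Properties using (map⁺; cartesianProduct⁺; allFin⁺)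
open import Data.List.Relation.Unary.AllPairs using ([]; _∷_)
open import Data.List.Relation.Unary.All using ([])
open import Data.List.Relation.Unary.Any using (here)
open import Data.Sum using (_⊎_; inj₁; inj₂; [_,_]′; fromInj₁; swap)
open import Data.Sum.Properties using (inj₁-injective)
open import Data.Product using (Σ; ∃; _×_; _,_; proj₁; proj₂)
open import Data.Unit using (⊤; tt)
open import Data.Empty using (⊥; ⊥-elim)
open import Function using (_∘_)
open import Function.Bundles using (_⇔_; mk⇔; Equivalence)
open import Function.Construct.Composition using (_⇔-∘_)
open import Function.Construct.Symmetry using (⇔-sym)
open import Function.Definitions using (Injective; StrictlySurjective)
open import Function.Consequences.Propositional
  using (surjective⇒strictlySurjective; strictlySurjective⇒surjective)
open import Relation.Binary.PropositionalEquality
  using (_≡_; _≢_; refl; sym; trans; cong; cong₂; subst; module ≡-Reasoning)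
open import Relation.Nullary using (¬_; ¬?; yes; no)
open import Relation.Nullary.Negation using (contraposition)
open import Relation.Unary using (Decidable)

open Equivalence using (to; from)

-- Counting

_⊗_ : {A B : Set} → (A → Set) → (B → Set) → A × B → Set
(P ⊗ Q) p = P (proj₁ p) × Q (proj₂ p)

module _ {A : Set} {P Q : A → Set} where

  Card-cong : ∀ {k} → (∀ x → P x ⇔ Q x) → Card P k → Card Q k
  Card-cong P⇔Q (xs , unique , mem , len) = xs , unique , (λ x → P⇔Q x ⇔-∘ mem x) , len

module _ {A B : Set} {P : A → Set} {Q : B → Set} where

  Card-transport : ∀ {k} (f : A → B) (g : B → A) →
    (∀ {x} → P x → Q (f x)) → (∀ {y} → Q y → P (g y)) →
    (∀ x → g (f x) ≡ x) → (∀ {y} → Q y → f (g y) ≡ y) →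
    Card P k → Card Q k
  Card-transport f g f-resp g-resp g∘f f∘g (xs , unique , mem , len) =
    map f xs , map⁺ f-injective unique , (λ y → mk⇔ (∈⇒Q y) Q⇒∈) , trans (length-map f xs) len
    where
    f-injective : ∀ {x y} → f x ≡ f y → x ≡ y
    f-injective {x} {y} e = trans (sym (g∘f x)) (trans (cong g e) (g∘f y))
    ∈⇒Q : ∀ y → y ∈ map f xs → Q y
    ∈⇒Q y y∈ with ∈-map⁻ f y∈
    ... | x , x∈ , refl = f-resp (to (mem x) x∈)
    Q⇒∈ : ∀ {y} → Q y → y ∈ map f xs
    Q⇒∈ {y} qy = subst (_∈ map f xs) (f∘g qy) (∈-map⁺ f (from (mem (g y)) (g-resp qy)))

  length-cartesianProduct : (xs : List A) (ys : List B) →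
    length (cartesianProduct xs ys) ≡ length xs * length ys
  length-cartesianProduct []       ys = refl
  length-cartesianProduct (x ∷ xs) ys =
    trans (length-++ (map (x ,_) ys)) (cong₂ _+_ (length-map (x ,_) ys) (length-cartesianProduct xs ys))

  Card-× : ∀ {k m} → Card P k → Card Q m → Card (P ⊗ Q) (k * m)
  Card-× (xs , xs-unique , xs-mem , refl) (ys , ys-unique , ys-mem , refl) =
    cartesianProduct xs ys , cartesianProduct⁺ xs-unique ys-unique ,
    (λ (x , y) → mk⇔ (λ xy∈ → let (x∈ , y∈) = ∈-cartesianProduct⁻ xs ys xy∈ in
                                  to (xs-mem x) x∈ , to (ys-mem y) y∈)
                     (λ (px , qy) → ∈-cartesianProduct⁺ (from (xs-mem x) px) (from (ys-mem y) qy))) ,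
    length-cartesianProduct xs ys

Card-Fin : ∀ m → Card {Fin m} (λ _ → ⊤) m
Card-Fin m = allFin m , allFin⁺ m , (λ x → mk⇔ _ (λ _ → ∈-allFin x)) , length-tabulate _

lookup-extensional : ∀ {A : Set} {m} {u v : Vec A m} → (∀ i → lookup u i ≡ lookup v i) → u ≡ v
lookup-extensional {u = u} {v} eq = trans (sym (tabulate∘lookup u)) (trans (tabulate-cong eq) (tabulate∘lookup v))

-- Permutation tables

record IsPermutation {m} (t : Tab m) : Set where
  constructor isPermutation
  field
    injective  : Injective _≡_ _≡_ (lookup t)
    surjective : StrictlySurjective _≡_ (lookup t)

IsPerm⇔IsPermutation : ∀ {m} (t : Tab m) → IsPerm t ⇔ IsPermutation t
IsPerm⇔IsPermutation t = mk⇔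
  (λ (injective , surjective) → isPermutation injective (surjective⇒strictlySurjective surjective))
  (λ (isPermutation injective surjective) → injective , strictlySurjective⇒surjective surjective)

punchOutOr : ∀ {m} → Fin m → Fin (suc m) → Fin (suc m) → Fin m
punchOutOr d i j with i ≟ j
... | yes _   = d
... | no i≢j = punchOut i≢j

punchIn-punchOutOr : ∀ {m} (d : Fin m) {i j} → i ≢ j → punchIn i (punchOutOr d i j) ≡ j
punchIn-punchOutOr d {i} {j} i≢j with i ≟ j
... | yes i≡j = ⊥-elim (i≢j i≡j)
... | no i≢j′ = punchIn-punchOut i≢j′

punchOutOr-punchIn : ∀ {m} (d : Fin m) i j → punchOutOr d i (punchIn i j) ≡ j
punchOutOr-punchIn d i j =
  punchIn-injective i _ _ (punchIn-punchOutOr d (λ i≡ → punchInᵢ≢i i j (sym i≡)))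

insertPerm : ∀ {m} → Fin (suc m) × Tab m → Tab (suc m)
insertPerm (a , π) = a ∷ Vec.map (punchIn a) π

removePerm : ∀ {m} → Tab (suc m) → Fin (suc m) × Tab m
removePerm (a ∷ π) = a , tabulate (λ k → punchOutOr k a (lookup π k))

head∉tail : ∀ {m} {a} {π : Vec (Fin (suc m)) m} → IsPermutation (a ∷ π) → ∀ k → a ≢ lookup π k
head∉tail (isPermutation injective _) k a≡ with injective {zero} {suc k} a≡
... | ()

insertPerm-IsPermutation : ∀ {m} a (π : Tab m) → IsPermutation π → IsPermutation (insertPerm (a , π))
insertPerm-IsPermutation a π (isPermutation injective surjective) = isPermutation injective′ surjective′
  where
  tail-lookup : ∀ k → lookup (insertPerm (a , π)) (suc k) ≡ punchIn a (lookup π k)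
  tail-lookup k = lookup-map k (punchIn a) π
  injective′ : Injective _≡_ _≡_ (lookup (insertPerm (a , π)))
  injective′ {zero}  {zero}  _ = refl
  injective′ {zero}  {suc l} e = ⊥-elim (punchInᵢ≢i a (lookup π l) (sym (trans e (tail-lookup l))))
  injective′ {suc k} {zero}  e = ⊥-elim (punchInᵢ≢i a (lookup π k) (trans (sym (tail-lookup k)) e))
  injective′ {suc k} {suc l} e =
    cong suc (injective (punchIn-injective a _ _ (trans (sym (tail-lookup k)) (trans e (tail-lookup l)))))
  surjective′ : StrictlySurjective _≡_ (lookup (insertPerm (a , π)))
  surjective′ y with a ≟ y
  ... | yes a≡y = zero , a≡y
  ... | no a≢y  = let (k , πk≡) = surjective (punchOut a≢y) in
    suc k , trans (tail-lookup k) (trans (cong (punchIn a) πk≡) (punchIn-punchOut a≢y))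

punchIn-removePerm : ∀ {m} {a} {π : Vec (Fin (suc m)) m} → IsPermutation (a ∷ π) →
  ∀ k → punchIn a (lookup (proj₂ (removePerm (a ∷ π))) k) ≡ lookup π k
punchIn-removePerm {a = a} t-perm k =
  trans (cong (punchIn a) (lookup∘tabulate _ k)) (punchIn-punchOutOr k (head∉tail t-perm k))

removePerm-IsPermutation : ∀ {m} (t : Tab (suc m)) → IsPermutation t → IsPermutation (proj₂ (removePerm t))
removePerm-IsPermutation {m} (a ∷ π) t-perm@(isPermutation injective surjective) =
  isPermutation injective′ surjective′
  where
  π′ : Tab m
  π′ = proj₂ (removePerm (a ∷ π))
  injective′ : Injective _≡_ _≡_ (lookup π′)
  injective′ {k} {l} e = suc-injective (injective {suc k} {suc l}
    (trans (sym (punchIn-removePerm t-perm k)) (trans (cong (punchIn a) e) (punchIn-removePerm t-perm l))))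
  surjective′ : StrictlySurjective _≡_ (lookup π′)
  surjective′ y with surjective (punchIn a y)
  ... | zero  , a≡ = ⊥-elim (punchInᵢ≢i a y (sym a≡))
  ... | suc k , πk≡ = k , punchIn-injective a _ _ (trans (punchIn-removePerm t-perm k) πk≡)

removePerm∘insertPerm : ∀ {m} (p : Fin (suc m) × Tab m) → removePerm (insertPerm p) ≡ p
removePerm∘insertPerm (a , π) = cong (a ,_) (lookup-extensional λ k →
  trans (lookup∘tabulate _ k) (trans (cong (punchOutOr k a) (lookup-map k (punchIn a) π)) (punchOutOr-punchIn k a _)))

insertPerm∘removePerm : ∀ {m} {t : Tab (suc m)} → IsPermutation t → insertPerm (removePerm t) ≡ t
insertPerm∘removePerm {t = a ∷ π} t-perm = cong (a ∷_) (lookup-extensional λ k →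
  trans (lookup-map k (punchIn a) (proj₂ (removePerm (a ∷ π)))) (punchIn-removePerm t-perm k))

Card-IsPermutation : ∀ m → Card (IsPermutation {m}) (m !)
Card-IsPermutation zero =
  ([] ∷ []) , ([] ∷ []) ,
  (λ { [] → mk⇔ (λ _ → isPermutation (λ { {()} }) (λ ())) (λ _ → here refl) }) , refl
Card-IsPermutation (suc m) =
  Card-transport insertPerm removePerm
    (λ { {a , π} (_ , π-perm) → insertPerm-IsPermutation a π π-perm })
    (λ {t} t-perm → tt , removePerm-IsPermutation t t-perm)
    removePerm∘insertPerm insertPerm∘removePerm
    (Card-× (Card-Fin (suc m)) (Card-IsPermutation m))

-- Splitting Fin b into the image of an injection and its complement

Image : ∀ {a} {B : Set} → (Fin a → B) → B → Set
Image f y = ∃ λ i → f i ≡ y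

module _ {b c} {P : Fin (suc b) → Set} {g : Fin c → Fin b} where

  EnumeratesOnto-keep : P zero → EnumeratesOnto g (P ∘ suc) → EnumeratesOnto (zero Vector.∷ suc ∘ g) P
  EnumeratesOnto-keep P0 (g-injective , g-onto) = injective , onto
    where
    injective : Injective _≡_ _≡_ (zero Vector.∷ suc ∘ g)
    injective {zero}  {zero}  _ = refl
    injective {suc i} {suc j} e = cong suc (g-injective (suc-injective e))
    injective {zero}  {suc _} ()
    injective {suc _} {zero}  ()
    onto : ∀ y → P y ⇔ Image (zero Vector.∷ suc ∘ g) y
    onto zero    = mk⇔ (λ _ → zero , refl) (λ _ → P0)
    onto (suc y) = mk⇔ (λ Py → let (i , gi≡) = to (g-onto y) Py in suc i , cong suc gi≡)
                       (λ { (zero , ()) ; (suc i , e) → from (g-onto y) (i , suc-injective e) })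

  EnumeratesOnto-skip : ¬ P zero → EnumeratesOnto g (P ∘ suc) → EnumeratesOnto (suc ∘ g) P
  EnumeratesOnto-skip ¬P0 (g-injective , g-onto) = g-injective ∘ suc-injective , onto
    where
    onto : ∀ y → P y ⇔ Image (suc ∘ g) y
    onto zero    = mk⇔ (⊥-elim ∘ ¬P0) (λ { (_ , ()) })
    onto (suc y) = mk⇔ (λ Py → let (i , gi≡) = to (g-onto y) Py in i , cong suc gi≡)
                       (λ (i , e) → from (g-onto y) (i , suc-injective e))

enumerate : ∀ {b} (P : Fin b → Set) → Decidable P → ∃ λ c → Σ (Fin c → Fin b) λ g → EnumeratesOnto g P
enumerate {zero}  P P? = 0 , (λ ()) , (λ { {()} }) , λ ()
enumerate {suc b} P P? with enumerate (P ∘ suc) (P? ∘ suc) | P? zero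
... | c , g , g-enum | yes P0 = suc c , _ , EnumeratesOnto-keep P0 g-enum
... | c , g , g-enum | no ¬P0 = c , _ , EnumeratesOnto-skip ¬P0 g-enum

record Splitting {a b c} (ρ : Fin a → Fin b) (ρᶜ : Fin c → Fin b) : Set where
  field
    which    : Fin b → Fin a ⊎ Fin c
    which-ρ  : ∀ i → which (ρ i) ≡ inj₁ i
    which-ρᶜ : ∀ j → which (ρᶜ j) ≡ inj₂ j
    ρ-which  : ∀ x → [ ρ , ρᶜ ]′ (which x) ≡ x

complementSplitting : ∀ {a b c} {ρ : Fin a → Fin b} {ρᶜ : Fin c → Fin b} →
  Injective _≡_ _≡_ ρ → EnumeratesOnto ρᶜ (¬_ ∘ Image ρ) → Splitting ρ ρᶜ
complementSplitting {a} {b} {c} {ρ} {ρᶜ} ρ-injective (ρᶜ-injective , ρᶜ-onto) = record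
  { which = which ; which-ρ = which-ρ ; which-ρᶜ = which-ρᶜ ; ρ-which = ρ-which }
  where
  which : Fin b → Fin a ⊎ Fin c
  which x with any? (λ i → ρ i ≟ x)
  ... | yes (i , _) = inj₁ i
  ... | no ¬im      = inj₂ (proj₁ (to (ρᶜ-onto x) ¬im))
  which-ρ : ∀ i → which (ρ i) ≡ inj₁ i
  which-ρ i with any? (λ i′ → ρ i′ ≟ ρ i)
  ... | yes (i′ , e) = cong inj₁ (ρ-injective e)
  ... | no ¬im       = ⊥-elim (¬im (i , refl))
  which-ρᶜ : ∀ j → which (ρᶜ j) ≡ inj₂ j
  which-ρᶜ j with any? (λ i → ρ i ≟ ρᶜ j)
  ... | yes im  = ⊥-elim (from (ρᶜ-onto (ρᶜ j)) (j , refl) im)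
  ... | no ¬im = cong inj₂ (ρᶜ-injective (proj₂ (to (ρᶜ-onto (ρᶜ j)) ¬im)))
  ρ-which : ∀ x → [ ρ , ρᶜ ]′ (which x) ≡ x
  ρ-which x with any? (λ i → ρ i ≟ x)
  ... | yes (i , e) = e
  ... | no ¬im      = proj₂ (to (ρᶜ-onto x) ¬im)

module _ {a b c} {ρ : Fin a → Fin b} {ρᶜ : Fin c → Fin b} (S : Splitting ρ ρᶜ) where
  open Splitting S

  which-[ρ,ρᶜ] : ∀ s → which ([ ρ , ρᶜ ]′ s) ≡ s
  which-[ρ,ρᶜ] (inj₁ i) = which-ρ i
  which-[ρ,ρᶜ] (inj₂ j) = which-ρᶜ j

  [ρ,ρᶜ]-injective : Injective _≡_ _≡_ [ ρ , ρᶜ ]′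
  [ρ,ρᶜ]-injective {s} {s′} e = trans (sym (which-[ρ,ρᶜ] s)) (trans (cong which e) (which-[ρ,ρᶜ] s′))

  which-injective : Injective _≡_ _≡_ which
  which-injective {x} {y} e = trans (sym (ρ-which x)) (trans (cong [ ρ , ρᶜ ]′ e) (ρ-which y))

  Splitting-size : c ≡ b ∸ a
  Splitting-size = trans (sym (m+n∸m≡n a c)) (cong (_∸ a) a+c≡b)
    where
    a+c≡b : a + c ≡ b
    a+c≡b = cantor-schröder-bernstein {f = [ ρ , ρᶜ ]′ ∘ splitAt a} {g = join a c ∘ which}
      (λ {x} {y} e → trans (sym (join-splitAt a c x))
        (trans (cong (join a c) ([ρ,ρᶜ]-injective {splitAt a x} {splitAt a y} e)) (join-splitAt a c y)))
      (λ {x} {y} e → which-injective (trans (sym (splitAt-join a c (which x)))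
        (trans (cong (splitAt a) e) (splitAt-join a c (which y)))))

record Complement {a b} (ρ : Fin a → Fin b) : Set where
  field
    size      : ℕ
    ρᶜ        : Fin size → Fin b
    splitting : Splitting ρ ρᶜ

complement : ∀ {a b} {ρ : Fin a → Fin b} → Injective _≡_ _≡_ ρ → Complement ρ
complement {ρ = ρ} ρ-injective with enumerate (¬_ ∘ Image ρ) (λ x → ¬? (any? λ i → ρ i ≟ x))
... | c , ρᶜ , ρᶜ-enum = record { size = c ; ρᶜ = ρᶜ ; splitting = complementSplitting ρ-injective ρᶜ-enum }

Card-IsPermutation-complement : ∀ {a b} {ρ : Fin a → Fin b} (C : Complement ρ) →
  Card (IsPermutation {Complement.size C}) ((b ∸ a) !)
Card-IsPermutation-complement C =
  subst (Card IsPermutation) (cong _! (Splitting-size splitting)) (Card-IsPermutation size)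
  where open Complement C

swapSplitting : ∀ {a b c} {ρ : Fin a → Fin b} {ρᶜ : Fin c → Fin b} → Splitting ρ ρᶜ → Splitting ρᶜ ρ
swapSplitting {ρ = ρ} {ρᶜ} S = record
  { which = swap ∘ which ; which-ρ = cong swap ∘ which-ρᶜ ; which-ρᶜ = cong swap ∘ which-ρ
  ; ρ-which = λ x → trans (swap-[,] (which x)) (ρ-which x) }
  where
  open Splitting S
  swap-[,] : ∀ s → [ ρᶜ , ρ ]′ (swap s) ≡ [ ρ , ρᶜ ]′ s
  swap-[,] (inj₁ _) = refl
  swap-[,] (inj₂ _) = refl

module Restriction {a b c} {ρ : Fin a → Fin b} {ρᶜ : Fin c → Fin b} (S : Splitting ρ ρᶜ) where
  open Splitting S

  data Side : Fin b → Set where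
    inside  : ∀ i → Side (ρ i)
    outside : ∀ j → Side (ρᶜ j)

  side : ∀ x → Side x
  side x = subst Side (ρ-which x) (side-[ρ,ρᶜ] (which x))
    where
    side-[ρ,ρᶜ] : ∀ s → Side ([ ρ , ρᶜ ]′ s)
    side-[ρ,ρᶜ] (inj₁ i) = inside i
    side-[ρ,ρᶜ] (inj₂ j) = outside j

  ρ-injective : Injective _≡_ _≡_ ρ
  ρ-injective {i} {i′} e = inj₁-injective (trans (sym (which-ρ i)) (trans (cong which e) (which-ρ i′)))

  ρ≢ρᶜ : ∀ i j → ρ i ≡ ρᶜ j → ⊥
  ρ≢ρᶜ i j e with trans (sym (which-ρ i)) (trans (cong which e) (which-ρᶜ j))
  ... | ()

  ¬Image⇒Imageᶜ : ∀ {x} → ¬ Image ρ x → Image ρᶜ x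
  ¬Image⇒Imageᶜ {x} ¬im with side x
  ... | inside i  = ⊥-elim (¬im (i , refl))
  ... | outside j = j , refl

  record Preserves (t : Tab b) : Set where
    constructor preserving
    field
      into  : ∀ i → Image ρ (lookup t (ρ i))
      intoᶜ : ∀ j → Image ρᶜ (lookup t (ρᶜ j))

  preserves : ∀ {P : Fin b → Set} {t} →
    (∀ x → P x ⇔ Image ρ x) → (∀ x → P x ⇔ P (lookup t x)) → Preserves t
  preserves {t = t} onto invariant = preserving
    (λ i → to (onto _) (to (invariant (ρ i)) (from (onto (ρ i)) (i , refl))))
    (λ j → ¬Image⇒Imageᶜ λ im →
      let (i , e) = to (onto (ρᶜ j)) (from (invariant (ρᶜ j)) (from (onto _) im)) in ρ≢ρᶜ i j e)

  -- The default i is never returned when t preserves the image of ρ.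
  restrict : Tab b → Tab a
  restrict t = tabulate λ i → fromInj₁ (λ _ → i) (which (lookup t (ρ i)))

  restrict-lookup : ∀ t {i i′} → ρ i′ ≡ lookup t (ρ i) → lookup (restrict t) i ≡ i′
  restrict-lookup t {i} {i′} e =
    trans (lookup∘tabulate _ i) (cong (fromInj₁ _) (trans (cong which (sym e)) (which-ρ i′)))

  restrict-spec : ∀ t → (∀ i → Image ρ (lookup t (ρ i))) →
    ∀ i → lookup t (ρ i) ≡ ρ (lookup (restrict t) i)
  restrict-spec t into i = let (i′ , e) = into i in trans (sym e) (cong ρ (sym (restrict-lookup t e)))

  restrict-unique : ∀ t {u} → (∀ i → lookup t (ρ i) ≡ ρ (lookup u i)) → restrict t ≡ u
  restrict-unique t t∘ρ≡ρ∘u = lookup-extensional λ i → restrict-lookup t (sym (t∘ρ≡ρ∘u i))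

  restrict-IsPermutation : ∀ {t} → IsPermutation t → Preserves t → IsPermutation (restrict t)
  restrict-IsPermutation {t} (isPermutation t-injective t-surjective) (preserving into intoᶜ) =
    isPermutation injective surjective
    where
    injective : Injective _≡_ _≡_ (lookup (restrict t))
    injective {i} {i′} e = ρ-injective (t-injective
      (trans (restrict-spec t into i) (trans (cong ρ e) (sym (restrict-spec t into i′)))))
    surjective-at : ∀ {i′ x} → Side x → lookup t x ≡ ρ i′ → ∃ λ i → lookup (restrict t) i ≡ i′
    surjective-at (inside i)  e = i , ρ-injective (trans (sym (restrict-spec t into i)) e)
    surjective-at (outside j) e = let (j′ , e′) = intoᶜ j in ⊥-elim (ρ≢ρᶜ _ j′ (sym (trans e′ e)))
    surjective : StrictlySurjective _≡_ (lookup (restrict t))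
    surjective i′ = let (x , e) = t-surjective (ρ i′) in surjective-at (side x) e

module Gluing {a b c} {ρ : Fin a → Fin b} {ρᶜ : Fin c → Fin b} (S : Splitting ρ ρᶜ) where
  open Splitting S
  open Restriction S public
  open Restriction (swapSplitting S) public using ()
    renaming (restrict to restrictᶜ; restrict-spec to restrictᶜ-spec; restrict-unique to restrictᶜ-unique;
              ρ-injective to ρᶜ-injective)
  private module Swapped = Restriction (swapSplitting S)

  restrictᶜ-IsPermutation : ∀ {t} → IsPermutation t → Preserves t → IsPermutation (restrictᶜ t)
  restrictᶜ-IsPermutation t-perm (preserving into intoᶜ) =
    Swapped.restrict-IsPermutation t-perm (Swapped.preserving intoᶜ into)

  glue : Tab a → Tab c → Tab b
  glue t tᶜ = tabulate ([ ρ ∘ lookup t , ρᶜ ∘ lookup tᶜ ]′ ∘ which)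

  glue-ρ : ∀ t tᶜ i → lookup (glue t tᶜ) (ρ i) ≡ ρ (lookup t i)
  glue-ρ t tᶜ i =
    trans (lookup∘tabulate _ (ρ i)) (cong [ ρ ∘ lookup t , ρᶜ ∘ lookup tᶜ ]′ (which-ρ i))

  glue-ρᶜ : ∀ t tᶜ j → lookup (glue t tᶜ) (ρᶜ j) ≡ ρᶜ (lookup tᶜ j)
  glue-ρᶜ t tᶜ j =
    trans (lookup∘tabulate _ (ρᶜ j)) (cong [ ρ ∘ lookup t , ρᶜ ∘ lookup tᶜ ]′ (which-ρᶜ j))

  restrict-glue : ∀ t tᶜ → restrict (glue t tᶜ) ≡ t
  restrict-glue t tᶜ = restrict-unique (glue t tᶜ) (glue-ρ t tᶜ)

  restrictᶜ-glue : ∀ t tᶜ → restrictᶜ (glue t tᶜ) ≡ tᶜ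
  restrictᶜ-glue t tᶜ = restrictᶜ-unique (glue t tᶜ) (glue-ρᶜ t tᶜ)

  glue-restrict : ∀ {t} → Preserves t → glue (restrict t) (restrictᶜ t) ≡ t
  glue-restrict {t} (preserving into intoᶜ) = lookup-extensional λ x → glue-restrict-at (side x)
    where
    glue-restrict-at : ∀ {x} → Side x → lookup (glue (restrict t) (restrictᶜ t)) x ≡ lookup t x
    glue-restrict-at (inside i)  = trans (glue-ρ (restrict t) (restrictᶜ t) i) (sym (restrict-spec t into i))
    glue-restrict-at (outside j) = trans (glue-ρᶜ (restrict t) (restrictᶜ t) j) (sym (restrictᶜ-spec t intoᶜ j))

  glue-IsPermutation : ∀ {t tᶜ} → IsPermutation t → IsPermutation tᶜ → IsPermutation (glue t tᶜ)
  glue-IsPermutation {t} {tᶜ} (isPermutation t-injective t-surjective) (isPermutation tᶜ-injective tᶜ-surjective) =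
    isPermutation (λ {x} {y} → injective-at (side x) (side y)) (surjective-at ∘ side)
    where
    g : Fin b → Fin b
    g = lookup (glue t tᶜ)
    injective-at : ∀ {x y} → Side x → Side y → g x ≡ g y → x ≡ y
    injective-at (inside i)  (inside i′)  e =
      cong ρ (t-injective (ρ-injective (trans (sym (glue-ρ t tᶜ i)) (trans e (glue-ρ t tᶜ i′)))))
    injective-at (inside i)  (outside j′) e =
      ⊥-elim (ρ≢ρᶜ _ _ (trans (sym (glue-ρ t tᶜ i)) (trans e (glue-ρᶜ t tᶜ j′))))
    injective-at (outside j) (inside i′)  e =
      ⊥-elim (ρ≢ρᶜ _ _ (trans (sym (glue-ρ t tᶜ i′)) (trans (sym e) (glue-ρᶜ t tᶜ j))))
    injective-at (outside j) (outside j′) e =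
      cong ρᶜ (tᶜ-injective (ρᶜ-injective (trans (sym (glue-ρᶜ t tᶜ j)) (trans e (glue-ρᶜ t tᶜ j′)))))
    surjective-at : ∀ {y} → Side y → ∃ λ x → g x ≡ y
    surjective-at (inside i)  = let (k , e) = t-surjective i in ρ k , trans (glue-ρ t tᶜ k) (cong ρ e)
    surjective-at (outside j) = let (k , e) = tᶜ-surjective j in ρᶜ k , trans (glue-ρᶜ t tᶜ k) (cong ρᶜ e)

¬-cong : ∀ {A B : Set} → A ⇔ B → (¬ A) ⇔ (¬ B)
¬-cong A⇔B = mk⇔ (contraposition (from A⇔B)) (contraposition (to A⇔B))

nothing-stable : ∀ {A : Set} {m : Maybe A} → ¬ ¬ (m ≡ nothing) → m ≡ nothing
nothing-stable {m = nothing} _   = refl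
nothing-stable {m = just _}  ¬¬e = ⊥-elim (¬¬e λ ())

map-square : ∀ {A B C D : Set} {f : A → B} {g : B → D} {f′ : C → D} {g′ : A → C} →
  (∀ z → g (f z) ≡ f′ (g′ z)) → ∀ m → Maybe.map g (Maybe.map f m) ≡ Maybe.map f′ (Maybe.map g′ m)
map-square square m = trans (sym (map-∘ m)) (trans (map-cong square m) (map-∘ m))

-- Autotopisms

Triple : ℕ → ℕ → ℕ → Set
Triple r s n = Tab r × Tab s × Tab n

Commutes : ∀ {r s n} → Array r s n → Triple r s n → Set
Commutes L (α , β , γ) = ∀ i j → L (lookup α i) (lookup β j) ≡ Maybe.map (lookup γ) (L i j)

IsAutotopism′ : ∀ {r s n} → Array r s n → Triple r s n → Set
IsAutotopism′ L θ@(α , β , γ) = IsPermutation α × IsPermutation β × IsPermutation γ × Commutes L θ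

module _ {r s n} {L : Array r s n} {α : Tab r} {β : Tab s} {γ : Tab n}
  (α-perm : IsPermutation α) (β-perm : IsPermutation β) (γ-perm : IsPermutation γ) where

  open IsPermutation

  Commutes⇒EntAct⇔Ent : Commutes L (α , β , γ) → ∀ t → EntAct (α , β , γ) L t ⇔ Ent L t
  Commutes⇒EntAct⇔Ent comm t = mk⇔ (entAct⇒ent t) (ent⇒entAct t)
    where
    entAct⇒ent : ∀ t → EntAct (α , β , γ) L t → Ent L t
    entAct⇒ent _ (i , j , x , e , refl , refl , refl) = trans (comm i j) (cong (Maybe.map (lookup γ)) e)
    ent⇒entAct : ∀ t → Ent L t → EntAct (α , β , γ) L t
    ent⇒entAct (i′ , j′ , x′) e with surjective α-perm i′ | surjective β-perm j′ | surjective γ-perm x′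
    ... | i , refl | j , refl | x , refl =
      i , j , x , map-injective (injective γ-perm) (trans (sym (comm i j)) e) , refl , refl , refl

  EntAct⇔Ent⇒Commutes : (∀ t → EntAct (α , β , γ) L t ⇔ Ent L t) → Commutes L (α , β , γ)
  EntAct⇔Ent⇒Commutes act⇔ent i j with L i j in eq
  ... | just x = to (act⇔ent _) (i , j , x , eq , refl , refl , refl)
  ... | nothing with L (lookup α i) (lookup β j) in eq′
  ...   | nothing = refl
  ...   | just _ with from (act⇔ent _) eq′
  ...     | i₀ , j₀ , _ , e₀ , αi₀≡ , βj₀≡ , _ with injective α-perm αi₀≡ | injective β-perm βj₀≡
  ...       | refl | refl with trans (sym eq) e₀
  ...         | ()

IsAutotopism⇔IsAutotopism′ : ∀ {r s n} (L : Array r s n) θ → IsAutotopism L θ ⇔ IsAutotopism′ L θ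
IsAutotopism⇔IsAutotopism′ L (α , β , γ) = mk⇔
  (λ (α-perm , β-perm , γ-perm , act⇔ent) →
    let α-perm′ = to (IsPerm⇔IsPermutation α) α-perm
        β-perm′ = to (IsPerm⇔IsPermutation β) β-perm
        γ-perm′ = to (IsPerm⇔IsPermutation γ) γ-perm
    in α-perm′ , β-perm′ , γ-perm′ , EntAct⇔Ent⇒Commutes α-perm′ β-perm′ γ-perm′ act⇔ent)
  (λ (α-perm , β-perm , γ-perm , comm) →
    from (IsPerm⇔IsPermutation α) α-perm , from (IsPerm⇔IsPermutation β) β-perm ,
    from (IsPerm⇔IsPermutation γ) γ-perm , Commutes⇒EntAct⇔Ent α-perm β-perm γ-perm comm)

module _ {r s n} {L : Array r s n} {α : Tab r} {β : Tab s} {γ : Tab n}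
  (α-perm : IsPermutation α) (β-perm : IsPermutation β) (γ-perm : IsPermutation γ)
  (comm : Commutes L (α , β , γ)) where

  open IsPermutation

  EmptyRow-invariant : ∀ x → EmptyRow L x ⇔ EmptyRow L (lookup α x)
  EmptyRow-invariant x = mk⇔
    (λ empty j′ → let (j , βj≡j′) = surjective β-perm j′ in
      subst (λ y → L (lookup α x) y ≡ nothing) βj≡j′ (trans (comm x j) (cong (Maybe.map (lookup γ)) (empty j))))
    (λ empty j → map-injective (injective γ-perm) (trans (sym (comm x j)) (empty (lookup β j))))

  EmptyCol-invariant : ∀ y → EmptyCol L y ⇔ EmptyCol L (lookup β y)
  EmptyCol-invariant y = mk⇔
    (λ empty i′ → let (i , αi≡i′) = surjective α-perm i′ in
      subst (λ x → L x (lookup β y) ≡ nothing) αi≡i′ (trans (comm i y) (cong (Maybe.map (lookup γ)) (empty i))))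
    (λ empty i → map-injective (injective γ-perm) (trans (sym (comm i y)) (empty (lookup α i))))

  Occurs-invariant : ∀ z → Occurs L z ⇔ Occurs L (lookup γ z)
  Occurs-invariant z = mk⇔
    (λ (i , j , e) → lookup α i , lookup β j , trans (comm i j) (cong (Maybe.map (lookup γ)) e))
    occurs-from
    where
    occurs-from : Occurs L (lookup γ z) → Occurs L z
    occurs-from (i′ , j′ , e) with surjective α-perm i′ | surjective β-perm j′
    ... | i , refl | j , refl = i , j , map-injective (injective γ-perm) (trans (sym (comm i j)) e)

module Reduction {r s n r′ s′ n′} {L : Array r s n} {Lbar : Array r′ s′ n′}
  {ρ : Fin r′ → Fin r} {σ : Fin s′ → Fin s} {τ : Fin n′ → Fin n}
  (ρ-enum : EnumeratesOnto ρ (λ x → ¬ EmptyRow L x))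
  (σ-enum : EnumeratesOnto σ (λ y → ¬ EmptyCol L y))
  (τ-enum : EnumeratesOnto τ (Occurs L))
  (L-ρσ : ∀ i j → L (ρ i) (σ j) ≡ Maybe.map τ (Lbar i j)) where

  rows : Complement ρ
  rows = complement (proj₁ ρ-enum)
  cols : Complement σ
  cols = complement (proj₁ σ-enum)
  syms : Complement τ
  syms = complement (proj₁ τ-enum)

  module Rows = Complement rows
  module Cols = Complement cols
  module Syms = Complement syms
  module R = Gluing Rows.splitting
  module C = Gluing Cols.splitting
  module S = Gluing Syms.splitting

  emptyRow-ρᶜ : ∀ j → EmptyRow L (Rows.ρᶜ j)
  emptyRow-ρᶜ j y = nothing-stable λ y≢ →
    let (i , e) = to (proj₂ ρ-enum _) (λ empty → y≢ (empty y)) in R.ρ≢ρᶜ i j e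

  emptyCol-σᶜ : ∀ j → EmptyCol L (Cols.ρᶜ j)
  emptyCol-σᶜ j x = nothing-stable λ x≢ →
    let (i , e) = to (proj₂ σ-enum _) (λ empty → x≢ (empty x)) in C.ρ≢ρᶜ i j e

  Pieces : Set
  Pieces = ((Tab Rows.size × Tab Cols.size) × Tab Syms.size) × Triple r′ s′ n′

  ValidPieces : Pieces → Set
  ValidPieces = ((IsPermutation ⊗ IsPermutation) ⊗ IsPermutation) ⊗ IsAutotopism′ Lbar

  glue : Pieces → Triple r s n
  glue (((αᶜ , βᶜ) , γᶜ) , (α̅ , β̅ , γ̅)) = R.glue α̅ αᶜ , C.glue β̅ βᶜ , S.glue γ̅ γᶜ

  restrict : Triple r s n → Pieces
  restrict (α , β , γ) =
    ((R.restrictᶜ α , C.restrictᶜ β) , S.restrictᶜ γ) , (R.restrict α , C.restrict β , S.restrict γ)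

  restrict∘glue : ∀ d → restrict (glue d) ≡ d
  restrict∘glue (((αᶜ , βᶜ) , γᶜ) , (α̅ , β̅ , γ̅)) =
    cong₂ _,_ (cong₂ _,_ (cong₂ _,_ (R.restrictᶜ-glue α̅ αᶜ) (C.restrictᶜ-glue β̅ βᶜ)) (S.restrictᶜ-glue γ̅ γᶜ))
              (cong₂ _,_ (R.restrict-glue α̅ αᶜ) (cong₂ _,_ (C.restrict-glue β̅ βᶜ) (S.restrict-glue γ̅ γᶜ)))

  glue-Commutes : ∀ αᶜ βᶜ γᶜ α̅ β̅ γ̅ → Commutes Lbar (α̅ , β̅ , γ̅) →
    Commutes L (glue (((αᶜ , βᶜ) , γᶜ) , (α̅ , β̅ , γ̅)))
  glue-Commutes αᶜ βᶜ γᶜ α̅ β̅ γ̅ comm̅ x y = commutes-at (R.side x) (C.side y)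
    where
    α : Tab r
    α = R.glue α̅ αᶜ
    β : Tab s
    β = C.glue β̅ βᶜ
    γ : Tab n
    γ = S.glue γ̅ γᶜ
    open ≡-Reasoning
    commutes-at : ∀ {x y} → R.Side x → C.Side y → L (lookup α x) (lookup β y) ≡ Maybe.map (lookup γ) (L x y)
    commutes-at (R.inside i) (C.inside j) = begin
      L (lookup α (ρ i)) (lookup β (σ j))            ≡⟨ cong₂ L (R.glue-ρ α̅ αᶜ i) (C.glue-ρ β̅ βᶜ j) ⟩
      L (ρ (lookup α̅ i)) (σ (lookup β̅ j))           ≡⟨ L-ρσ _ _ ⟩
      Maybe.map τ (Lbar (lookup α̅ i) (lookup β̅ j))  ≡⟨ cong (Maybe.map τ) (comm̅ i j) ⟩
      Maybe.map τ (Maybe.map (lookup γ̅) (Lbar i j))  ≡⟨ map-square (λ z → sym (S.glue-ρ γ̅ γᶜ z)) (Lbar i j) ⟩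
      Maybe.map (lookup γ) (Maybe.map τ (Lbar i j))  ≡⟨ cong (Maybe.map (lookup γ)) (sym (L-ρσ i j)) ⟩
      Maybe.map (lookup γ) (L (ρ i) (σ j))            ∎
    commutes-at {y = y} (R.outside i) _ = begin
      L (lookup α (Rows.ρᶜ i)) (lookup β y)  ≡⟨ cong (λ x′ → L x′ (lookup β y)) (R.glue-ρᶜ α̅ αᶜ i) ⟩
      L (Rows.ρᶜ (lookup αᶜ i)) (lookup β y) ≡⟨ emptyRow-ρᶜ _ _ ⟩
      nothing                                ≡⟨ cong (Maybe.map (lookup γ)) (sym (emptyRow-ρᶜ i y)) ⟩
      Maybe.map (lookup γ) (L (Rows.ρᶜ i) y)  ∎
    commutes-at {x = x} (R.inside _) (C.outside j) = begin
      L (lookup α x) (lookup β (Cols.ρᶜ j))  ≡⟨ cong (L (lookup α x)) (C.glue-ρᶜ β̅ βᶜ j) ⟩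
      L (lookup α x) (Cols.ρᶜ (lookup βᶜ j)) ≡⟨ emptyCol-σᶜ _ _ ⟩
      nothing                                ≡⟨ cong (Maybe.map (lookup γ)) (sym (emptyCol-σᶜ j x)) ⟩
      Maybe.map (lookup γ) (L x (Cols.ρᶜ j))  ∎

  glue-IsAutotopism′ : ∀ d → ValidPieces d → IsAutotopism′ L (glue d)
  glue-IsAutotopism′ (((αᶜ , βᶜ) , γᶜ) , (α̅ , β̅ , γ̅))
                     (((αᶜ-perm , βᶜ-perm) , γᶜ-perm) , (α̅-perm , β̅-perm , γ̅-perm , comm̅)) =
    R.glue-IsPermutation α̅-perm αᶜ-perm , C.glue-IsPermutation β̅-perm βᶜ-perm ,
    S.glue-IsPermutation γ̅-perm γᶜ-perm , glue-Commutes αᶜ βᶜ γᶜ α̅ β̅ γ̅ comm̅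

  module _ {α β γ} (α-perm : IsPermutation α) (β-perm : IsPermutation β) (γ-perm : IsPermutation γ)
           (comm : Commutes L (α , β , γ)) where

    α-preserves : R.Preserves α
    α-preserves = R.preserves (proj₂ ρ-enum) λ x → ¬-cong (EmptyRow-invariant α-perm β-perm γ-perm comm x)

    β-preserves : C.Preserves β
    β-preserves = C.preserves (proj₂ σ-enum) λ y → ¬-cong (EmptyCol-invariant α-perm β-perm γ-perm comm y)

    γ-preserves : S.Preserves γ
    γ-preserves = S.preserves (proj₂ τ-enum) (Occurs-invariant α-perm β-perm γ-perm comm)

    restrict-Commutes : Commutes Lbar (R.restrict α , C.restrict β , S.restrict γ)
    restrict-Commutes i j = map-injective (proj₁ τ-enum) (begin
      Maybe.map τ (Lbar (lookup α̅ i) (lookup β̅ j))  ≡⟨ sym (L-ρσ _ _) ⟩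
      L (ρ (lookup α̅ i)) (σ (lookup β̅ j))           ≡⟨ sym (cong₂ L (R.restrict-spec α α-into i) (C.restrict-spec β β-into j)) ⟩
      L (lookup α (ρ i)) (lookup β (σ j))            ≡⟨ comm (ρ i) (σ j) ⟩
      Maybe.map (lookup γ) (L (ρ i) (σ j))            ≡⟨ cong (Maybe.map (lookup γ)) (L-ρσ i j) ⟩
      Maybe.map (lookup γ) (Maybe.map τ (Lbar i j))  ≡⟨ map-square (S.restrict-spec γ γ-into) (Lbar i j) ⟩
      Maybe.map τ (Maybe.map (lookup γ̅) (Lbar i j))  ∎)
      where
      open ≡-Reasoning
      open R.Preserves α-preserves using () renaming (into to α-into)
      open C.Preserves β-preserves using () renaming (into to β-into)
      open S.Preserves γ-preserves using () renaming (into to γ-into)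
      α̅ : Tab r′
      α̅ = R.restrict α
      β̅ : Tab s′
      β̅ = C.restrict β
      γ̅ : Tab n′
      γ̅ = S.restrict γ

    restrict-ValidPieces : ValidPieces (restrict (α , β , γ))
    restrict-ValidPieces =
      ((R.restrictᶜ-IsPermutation α-perm α-preserves , C.restrictᶜ-IsPermutation β-perm β-preserves) ,
        S.restrictᶜ-IsPermutation γ-perm γ-preserves) ,
      (R.restrict-IsPermutation α-perm α-preserves , C.restrict-IsPermutation β-perm β-preserves ,
        S.restrict-IsPermutation γ-perm γ-preserves , restrict-Commutes)

    glue∘restrict : glue (restrict (α , β , γ)) ≡ (α , β , γ)
    glue∘restrict = cong₂ _,_ (R.glue-restrict α-preserves)
                      (cong₂ _,_ (C.glue-restrict β-preserves) (S.glue-restrict γ-preserves))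

  Card-IsAutotopism′ : ∀ {k} → Card (IsAutotopism′ Lbar) k →
    Card (IsAutotopism′ L) ((r ∸ r′) ! * (s ∸ s′) ! * (n ∸ n′) ! * k)
  Card-IsAutotopism′ card =
    Card-transport glue restrict (glue-IsAutotopism′ _)
      (λ (α-perm , β-perm , γ-perm , comm) → restrict-ValidPieces α-perm β-perm γ-perm comm) restrict∘glue
      (λ (α-perm , β-perm , γ-perm , comm) → glue∘restrict α-perm β-perm γ-perm comm)
      (Card-× (Card-× (Card-× (Card-IsPermutation-complement rows) (Card-IsPermutation-complement cols))
                      (Card-IsPermutation-complement syms))
              card)

lemma2 : (r s n r' s' n' : ℕ) (L : Array r s n) (Lbar : Array r' s' n') →
    IsPLR L → IsReduction L Lbar →
    (k : ℕ) → Card (IsAutotopism Lbar) k →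
    Card (IsAutotopism L) ((r ∸ r') ! * (s ∸ s') ! * (n ∸ n') ! * k)
lemma2 r s n r' s' n' L Lbar _ (ρ , σ , τ , _ , ρ-enum , _ , σ-enum , τ-enum , L-ρσ) k card =
  Card-cong (λ θ → ⇔-sym (IsAutotopism⇔IsAutotopism′ L θ))
    (Reduction.Card-IsAutotopism′ {Lbar = Lbar} ρ-enum σ-enum τ-enum L-ρσ
      (Card-cong (IsAutotopism⇔IsAutotopism′ Lbar) card))
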